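{- Let $m,n\ge 1$ and let $M=(m_{ij})$ be an $m\times n$ matrix with entries in $\{0,1\}$. For $i\in\{1,\dots,m\}$ let $\delta_i=\frac{1}{n}\sum_{j=1}^n m_{ij}$ be the density of the $i$-th row. Suppose the set $\{t\in\{1,\dots,n\} : \sum_{l=1}^{m}(1-\delta_l)^t<1\}$ is nonempty, and let $$k=\min\Big\{t\in\{1,\dots,n\} : \sum_{l=1}^{m}(1-\delta_l)^t<1\Big\}.$$ Then there exists a covering $J$ of $M$ with $|J|=k$, i.e. a set $J\subseteq\{1,\dots,n\}$ of $k$ columns such that $\sum_{j\in J}m_{ij}>0$ for every $i\in\{1,\dots,m\}$.
   Context: A covering of a $0$-$1$ matrix $M$ is a set $J$ of column indices such that every row of $M$ has an entry equal to $1$ in some column of $J$ (this is the Set Covering Problem with unit costs). -}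

module Defs where

open import Data.Nat as ℕ using (ℕ; zero; suc; NonZero)
open import Data.Integer using (+_)
open import Data.Fin using (Fin)
open import Data.Fin.Subset using (Subset; _∈_; ∣_∣)
open import Data.Bool using (Bool; true; false)
open import Data.Product using (Σ; _×_)
open import Data.Rational using (ℚ; 0ℚ; 1ℚ; _+_; _-_; _*_; _/_)
open import Relation.Binary.PropositionalEquality using (_≡_)

Matrix01 : ℕ → ℕ → Set
Matrix01 m n = Fin m → Fin n → Bool

val : Bool → ℕ
val true  = 1
val false = 0

sumℕ : ∀ {k} → (Fin k → ℕ) → ℕ
sumℕ {zero}  f = 0
sumℕ {suc k} f = f Data.Fin.zero ℕ.+ sumℕ (λ i → f (Data.Fin.suc i))

sumℚ : ∀ {k} → (Fin k → ℚ) → ℚ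
sumℚ {zero}  f = 0ℚ
sumℚ {suc k} f = f Data.Fin.zero + sumℚ (λ i → f (Data.Fin.suc i))

_^ℚ_ : ℚ → ℕ → ℚ
q ^ℚ zero  = 1ℚ
q ^ℚ suc t = q * (q ^ℚ t)

density : ∀ {m n} .{{_ : NonZero n}} → Matrix01 m n → Fin m → ℚ
density {n = n} M i = (+ sumℕ (λ j → val (M i j))) / n

S : ∀ {m n} .{{_ : NonZero n}} → Matrix01 m n → ℕ → ℚ
S M t = sumℚ (λ l → (1ℚ - density M l) ^ℚ t)

IsCovering : ∀ {m n} → Matrix01 m n → Subset n → Set
IsCovering M J = ∀ i → Σ _ (λ j → (j ∈ J) × (M i j ≡ true))

-- Let z_l be the number of zeros in row l. For a set of still uncovered rows,
-- Σ_l z_l^t / n^t is the expected number of them missed by t independent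
-- uniformly random columns. Conditioning on the first column, this is the
-- average over the columns j of the same quantity for t - 1 columns and the
-- rows that j leaves uncovered. So if it is below 1, some column keeps it
-- below 1 with one column fewer, and when no column is left it is the number
-- of uncovered rows, hence 0. Since 1 - δ_l = z_l / n, the hypothesis
-- S(k) < 1 says exactly that Σ_l z_l^k < n^k, so at most k columns cover M,
-- and such a cover can be padded to exactly k columns.
module Submission where

open import Data.Bool using (Bool; true; false; not; _∧_)
open import Data.Empty using (⊥-elim)
open import Data.Fin using (Fin; zero; suc)
open import Data.Fin.Subset using (Subset; ∣_∣; _∈_; _⊆_; _∪_; ⁅_⁆; ⊥; ⊤; inside; outside)
open import Data.Fin.Subset.Properties
  using (∣p∣≤∣x∷p∣; ∣⊥∣≡0; ∣⊤∣≡n; ⊆⊤; ∣⁅x⁆∣≡1; x∈⁅x⁆; p⊆p∪q; q⊆p∪q)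
open import Data.Integer as ℤ using (+_)
import Data.Integer.Properties as ℤ
open import Data.Nat as ℕ using (ℕ; zero; suc; NonZero; _≤_; _<_; z≤n; s≤s; _^_)
import Data.Nat.Properties as ℕ
open import Data.Product using (Σ; ∃; _×_; _,_)
open import Data.Rational as ℚ using (ℚ; 1ℚ; _+_; _-_; _*_; _/_)
  renaming (_<_ to _<ℚ_)
open import Data.Rational.Literals using (fromℤ)
import Data.Rational.Properties as ℚ
open import Data.Rational.Solver using (module +-*-Solver)
import Data.Rational.Unnormalised as ℚᵘ
import Data.Rational.Unnormalised.Properties as ℚᵘ
open import Data.Vec using ([]; _∷_; here; there)
open import Function using (_∘_)
open import Relation.Binary.PropositionalEquality
open import Relation.Nullary using (¬_; yes; no)

open import Defs

open import Algebra.Properties.Semiring.Sum ℕ.+-*-semiring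
  using (sum; sum-syntax; sum-cong-≗; sum-remove; ∑-distrib-+; ∑-comm; *-distribˡ-sum; *-distribʳ-sum)

sumℕ≡sum : ∀ {k} (f : Fin k → ℕ) → sumℕ f ≡ sum f
sumℕ≡sum {zero}  f = refl
sumℕ≡sum {suc k} f = cong (f zero ℕ.+_) (sumℕ≡sum (f ∘ suc))

∑-1 : ∀ k → ∑[ i < k ] 1 ≡ k
∑-1 zero    = refl
∑-1 (suc k) = cong suc (∑-1 k)

≤-sum : ∀ {k} (f : Fin k → ℕ) i → f i ≤ sum f
≤-sum {suc k} f i = subst (f i ≤_) (sym (sum-remove {i = i} f)) (ℕ.m≤m+n _ _)

∃-below-average : ∀ {k} (f : Fin k → ℕ) X → sum f < k ℕ.* X → ∃ λ i → f i < X
∃-below-average {zero}  f X ()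
∃-below-average {suc k} f X sum<k*X with f zero ℕ.<? X
... | yes f0<X = zero , f0<X
... | no  f0≮X =
  let i , fi<X = ∃-below-average (f ∘ suc) X
                   (ℕ.+-cancelˡ-< X _ _ (ℕ.≤-<-trans (ℕ.+-monoˡ-≤ _ (ℕ.≮⇒≥ f0≮X)) sum<k*X))
  in suc i , fi<X

val-∧ : ∀ a b → val (a ∧ b) ≡ val a ℕ.* val b
val-∧ true  b = sym (ℕ.+-identityʳ (val b))
val-∧ false b = refl

val-not+val : ∀ b → val (not b) ℕ.+ val b ≡ 1
val-not+val true  = refl
val-not+val false = refl

count-not+count : ∀ {k} (b : Fin k → Bool) → ∑[ i < k ] val (not (b i)) ℕ.+ ∑[ i < k ] val (b i) ≡ k
count-not+count {k} b = begin
  ∑[ i < k ] val (not (b i)) ℕ.+ ∑[ i < k ] val (b i) ≡⟨ ∑-distrib-+ (val ∘ not ∘ b) (val ∘ b) ⟨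
  ∑[ i < k ] (val (not (b i)) ℕ.+ val (b i))           ≡⟨ sum-cong-≗ (val-not+val ∘ b) ⟩
  ∑[ i < k ] 1                                         ≡⟨ ∑-1 k ⟩
  k                                                    ∎
  where open ≡-Reasoning

∣p∪q∣≤∣p∣+∣q∣ : ∀ {n} (p q : Subset n) → ∣ p ∪ q ∣ ≤ ∣ p ∣ ℕ.+ ∣ q ∣
∣p∪q∣≤∣p∣+∣q∣ []            []            = z≤n
∣p∪q∣≤∣p∣+∣q∣ (inside ∷ p)  (s ∷ q)       =
  s≤s (ℕ.≤-trans (∣p∪q∣≤∣p∣+∣q∣ p q) (ℕ.+-monoʳ-≤ ∣ p ∣ (∣p∣≤∣x∷p∣ s q)))
∣p∪q∣≤∣p∣+∣q∣ (outside ∷ p) (inside ∷ q)  =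
  subst (suc ∣ p ∪ q ∣ ≤_) (sym (ℕ.+-suc ∣ p ∣ ∣ q ∣)) (s≤s (∣p∪q∣≤∣p∣+∣q∣ p q))
∣p∪q∣≤∣p∣+∣q∣ (outside ∷ p) (outside ∷ q) = ∣p∪q∣≤∣p∣+∣q∣ p q

superset-of-size : ∀ {n} t (p : Subset n) → ∣ p ∣ ≤ t → t ≤ n → ∃ λ q → ∣ q ∣ ≡ t × p ⊆ q
superset-of-size zero    []           _          _         = [] , refl , λ ()
superset-of-size (suc t) (inside ∷ p) (s≤s ∣p∣≤t) (s≤s t≤n) =
  let q , ∣q∣≡t , p⊆q = superset-of-size t p ∣p∣≤t t≤n
  in inside ∷ q , cong suc ∣q∣≡t , λ { here → here ; (there x∈p) → there (p⊆q x∈p) }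
superset-of-size {suc n} t (outside ∷ p) ∣p∣≤t t≤1+n with t ℕ.≤? n
... | yes t≤n =
  let q , ∣q∣≡t , p⊆q = superset-of-size t p ∣p∣≤t t≤n
  in outside ∷ q , ∣q∣≡t , λ { (there x∈p) → there (p⊆q x∈p) }
... | no t≰n = ⊤ , trans (∣⊤∣≡n (suc n)) (ℕ.≤-antisym (ℕ.≰⇒> t≰n) t≤1+n) , ⊆⊤

fromℕ : ℕ → ℚ
fromℕ a = fromℤ (+ a)

fromℕ-homo-+ : ∀ a b → fromℕ (a ℕ.+ b) ≡ fromℕ a + fromℕ b
fromℕ-homo-+ a b = ℚ.toℚᵘ-injective (ℚᵘ.≃-trans (ℚᵘ.*≡* (cong (ℤ._* + 1) +[a+b]≡+a*1++b*1))
  (ℚᵘ.≃-sym (ℚ.toℚᵘ-homo-+ (fromℕ a) (fromℕ b))))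
  where
  +[a+b]≡+a*1++b*1 : + (a ℕ.+ b) ≡ + a ℤ.* + 1 ℤ.+ + b ℤ.* + 1
  +[a+b]≡+a*1++b*1 = trans (ℤ.pos-+ a b) (sym (cong₂ ℤ._+_ (ℤ.*-identityʳ (+ a)) (ℤ.*-identityʳ (+ b))))

fromℕ-homo-* : ∀ a b → fromℕ (a ℕ.* b) ≡ fromℕ a * fromℕ b
fromℕ-homo-* a b = ℚ.toℚᵘ-injective (ℚᵘ.≃-trans (ℚᵘ.*≡* (cong (ℤ._* + 1) (ℤ.pos-* a b)))
  (ℚᵘ.≃-sym (ℚ.toℚᵘ-homo-* (fromℕ a) (fromℕ b))))

fromℕ-cancel-< : ∀ {a b} → fromℕ a <ℚ fromℕ b → a < b
fromℕ-cancel-< {a} {b} a<b = ℤ.drop‿+<+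
  (subst₂ ℤ._<_ (ℤ.*-identityʳ (+ a)) (ℤ.*-identityʳ (+ b)) (ℚᵘ.drop-*<* (ℚ.toℚᵘ-mono-< a<b)))

fromℕ-pos : ∀ a .{{_ : NonZero a}} → ℚ.Positive (fromℕ a)
fromℕ-pos (suc a) = _

fromℕ-homo-^ : ∀ a t → fromℕ (a ^ t) ≡ fromℕ a ^ℚ t
fromℕ-homo-^ a zero    = refl
fromℕ-homo-^ a (suc t) = trans (fromℕ-homo-* a (a ^ t)) (cong (fromℕ a *_) (fromℕ-homo-^ a t))

/-*-fromℕ : ∀ c n .{{_ : NonZero n}} → (+ c / n) * fromℕ n ≡ fromℕ c
/-*-fromℕ c (suc n) = ℚ.toℚᵘ-injective (ℚᵘ.≃-trans (ℚ.toℚᵘ-homo-* (+ c / suc n) (fromℕ (suc n)))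
  (ℚᵘ.≃-trans (ℚᵘ.*-congʳ (ℚ.toℚᵘ-fromℚᵘ (ℚᵘ.mkℚᵘ (+ c) n)))
  (ℚᵘ.*≡* (trans (ℤ.*-identityʳ _) (cong (λ d → + c ℤ.* + d) (sym (ℕ.*-identityʳ (suc n))))))))

^ℚ-distrib-* : ∀ p q t → (p * q) ^ℚ t ≡ p ^ℚ t * q ^ℚ t
^ℚ-distrib-* p q zero    = refl
^ℚ-distrib-* p q (suc t) = trans (cong (p * q *_) (^ℚ-distrib-* p q t)) (interchange p q _ _)
  where
  open +-*-Solver
  interchange : ∀ p q x y → p * q * (x * y) ≡ p * x * (q * y)
  interchange = solve 4 (λ p q x y → p :* q :* (x :* y) := p :* x :* (q :* y)) refl

sumℚ-*-fromℕ : ∀ {k} (f : Fin k → ℚ) (g : Fin k → ℕ) x →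
               (∀ i → f i * x ≡ fromℕ (g i)) → sumℚ f * x ≡ fromℕ (sum g)
sumℚ-*-fromℕ {zero}  f g x _      = ℚ.*-zeroˡ x
sumℚ-*-fromℕ {suc k} f g x fx≡gi = begin
  (f zero + sumℚ (f ∘ suc)) * x          ≡⟨ ℚ.*-distribʳ-+ x (f zero) _ ⟩
  f zero * x + sumℚ (f ∘ suc) * x        ≡⟨ cong₂ _+_ (fx≡gi zero) (sumℚ-*-fromℕ (f ∘ suc) (g ∘ suc) x (fx≡gi ∘ suc)) ⟩
  fromℕ (g zero) + fromℕ (sum (g ∘ suc)) ≡⟨ fromℕ-homo-+ (g zero) _ ⟨
  fromℕ (sum g)                          ∎
  where open ≡-Reasoning

module Covering {m n} (M : Matrix01 m n) where

  zeros : Fin m → ℕ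
  zeros l = ∑[ j < n ] val (not (M l j))

  weight : (Fin m → Bool) → ℕ → ℕ
  weight active t = ∑[ l < m ] (val (active l) ℕ.* zeros l ^ t)

  uncoveredBy : Fin n → (Fin m → Bool) → Fin m → Bool
  uncoveredBy j active l = active l ∧ not (M l j)

  Covers : Subset n → (Fin m → Bool) → Set
  Covers J active = ∀ l → active l ≡ true → ∃ λ j → j ∈ J × M l j ≡ true

  weight-suc : ∀ active t → weight active (suc t) ≡ ∑[ j < n ] weight (uncoveredBy j active) t
  weight-suc active t =
    trans (sum-cong-≗ row) (∑-comm (λ l j → val (uncoveredBy j active l) ℕ.* zeros l ^ t))
    where
    row : ∀ l → val (active l) ℕ.* (zeros l ℕ.* zeros l ^ t)
              ≡ ∑[ j < n ] (val (uncoveredBy j active l) ℕ.* zeros l ^ t)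
    row l = begin
      val (active l) ℕ.* (zeros l ℕ.* zeros l ^ t)
        ≡⟨ ℕ.*-assoc (val (active l)) (zeros l) _ ⟨
      val (active l) ℕ.* zeros l ℕ.* zeros l ^ t
        ≡⟨ cong (ℕ._* zeros l ^ t) (*-distribˡ-sum (val (active l)) (λ j → val (not (M l j)))) ⟩
      (∑[ j < n ] (val (active l) ℕ.* val (not (M l j)))) ℕ.* zeros l ^ t
        ≡⟨ *-distribʳ-sum (zeros l ^ t) (λ j → val (active l) ℕ.* val (not (M l j))) ⟩
      ∑[ j < n ] (val (active l) ℕ.* val (not (M l j)) ℕ.* zeros l ^ t)
        ≡⟨ sum-cong-≗ (λ j → cong (ℕ._* zeros l ^ t) (val-∧ (active l) (not (M l j)))) ⟨
      ∑[ j < n ] (val (uncoveredBy j active l) ℕ.* zeros l ^ t)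
        ∎
      where open ≡-Reasoning

  light⇒covered : ∀ t active → weight active t < n ^ t → ∃ λ J → ∣ J ∣ ≤ t × Covers J active
  light⇒covered zero active weight<1 = ⊥ , ℕ.≤-reflexive (∣⊥∣≡0 n) , none-active
    where
    none-active : Covers ⊥ active
    none-active l active-l = ⊥-elim (ℕ.<⇒≱ weight<1
      (subst (λ b → val b ℕ.* 1 ≤ weight active 0) active-l (≤-sum _ l)))
  light⇒covered (suc t) active weight<n^1+t
    with ∃-below-average (λ j → weight (uncoveredBy j active) t) (n ^ t)
           (subst (_< n ^ suc t) (weight-suc active t) weight<n^1+t)
  ... | j , weight<n^t with light⇒covered t (uncoveredBy j active) weight<n^t
  ...   | J , ∣J∣≤t , J-covers = ⁅ j ⁆ ∪ J , ∣⁅j⁆∪J∣≤1+t , covers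
    where
    ∣⁅j⁆∪J∣≤1+t : ∣ ⁅ j ⁆ ∪ J ∣ ≤ suc t
    ∣⁅j⁆∪J∣≤1+t = ℕ.≤-trans (∣p∪q∣≤∣p∣+∣q∣ ⁅ j ⁆ J) (ℕ.+-mono-≤ (ℕ.≤-reflexive (∣⁅x⁆∣≡1 j)) ∣J∣≤t)

    covers : Covers (⁅ j ⁆ ∪ J) active
    covers l active-l with M l j in Mlj
    ... | true  = j , p⊆p∪q J (x∈⁅x⁆ j) , Mlj
    ... | false =
      let j′ , j′∈J , Mlj′ = J-covers l (cong₂ (λ a b → a ∧ not b) active-l Mlj)
      in j′ , q⊆p∪q ⁅ j ⁆ J j′∈J , Mlj′

  Covers-⊆ : ∀ {J J′} active → J ⊆ J′ → Covers J active → Covers J′ active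
  Covers-⊆ active J⊆J′ J-covers l active-l =
    let j , j∈J , Mlj = J-covers l active-l in j , J⊆J′ j∈J , Mlj

module _ {m n} .{{_ : NonZero n}} (M : Matrix01 m n) where
  open Covering M

  [1-density]*n≡zeros : ∀ l → (1ℚ - density M l) * fromℕ n ≡ fromℕ (zeros l)
  [1-density]*n≡zeros l = begin
    (1ℚ - + ones / n) * fromℕ n                      ≡⟨ [1-p]*q≡q-p*q (+ ones / n) (fromℕ n) ⟩
    fromℕ n - + ones / n * fromℕ n                   ≡⟨ cong₂ _-_ (cong fromℕ (sym zeros+ones≡n)) (/-*-fromℕ ones n) ⟩
    fromℕ (zeros l ℕ.+ ones) - fromℕ ones            ≡⟨ cong (_- fromℕ ones) (fromℕ-homo-+ (zeros l) ones) ⟩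
    fromℕ (zeros l) + fromℕ ones - fromℕ ones        ≡⟨ p+q-q≡p (fromℕ (zeros l)) (fromℕ ones) ⟩
    fromℕ (zeros l)                                  ∎
    where
    open ≡-Reasoning
    open +-*-Solver
    ones = sumℕ (λ j → val (M l j))
    zeros+ones≡n : zeros l ℕ.+ ones ≡ n
    zeros+ones≡n = trans (cong (zeros l ℕ.+_) (sumℕ≡sum (λ j → val (M l j)))) (count-not+count (M l))
    [1-p]*q≡q-p*q : ∀ p q → (1ℚ - p) * q ≡ q - p * q
    [1-p]*q≡q-p*q = solve 2 (λ p q → (con 1ℚ :- p) :* q := q :- p :* q) refl
    p+q-q≡p : ∀ p q → p + q - q ≡ p
    p+q-q≡p = solve 2 (λ p q → p :+ q :- q := p) refl

  S*n^t≡weight : ∀ t → S M t * fromℕ (n ^ t) ≡ fromℕ (weight (λ _ → true) t)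
  S*n^t≡weight t = sumℚ-*-fromℕ _ _ (fromℕ (n ^ t)) row
    where
    open ≡-Reasoning
    row : ∀ l → (1ℚ - density M l) ^ℚ t * fromℕ (n ^ t) ≡ fromℕ (1 ℕ.* zeros l ^ t)
    row l = begin
      (1ℚ - density M l) ^ℚ t * fromℕ (n ^ t)   ≡⟨ cong ((1ℚ - density M l) ^ℚ t *_) (fromℕ-homo-^ n t) ⟩
      (1ℚ - density M l) ^ℚ t * fromℕ n ^ℚ t    ≡⟨ ^ℚ-distrib-* (1ℚ - density M l) (fromℕ n) t ⟨
      ((1ℚ - density M l) * fromℕ n) ^ℚ t       ≡⟨ cong (_^ℚ t) ([1-density]*n≡zeros l) ⟩
      fromℕ (zeros l) ^ℚ t                      ≡⟨ fromℕ-homo-^ (zeros l) t ⟨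
      fromℕ (zeros l ^ t)                       ≡⟨ cong fromℕ (ℕ.*-identityˡ (zeros l ^ t)) ⟨
      fromℕ (1 ℕ.* zeros l ^ t)                 ∎

  S<1⇒light : ∀ t → S M t <ℚ 1ℚ → weight (λ _ → true) t < n ^ t
  S<1⇒light t S<1 = fromℕ-cancel-< (subst₂ _<ℚ_ (S*n^t≡weight t) (ℚ.*-identityˡ _) S*n^t<n^t)
    where
    instance
      n^t≢0 : NonZero (n ^ t)
      n^t≢0 = ℕ.m^n≢0 n t
    S*n^t<n^t : S M t * fromℕ (n ^ t) <ℚ 1ℚ * fromℕ (n ^ t)
    S*n^t<n^t = ℚ.*-monoˡ-<-pos (fromℕ (n ^ t)) {{fromℕ-pos (n ^ t)}} S<1

theorem3p1 : (m n : ℕ) → 1 ≤ m → .{{_ : NonZero n}} → (M : Matrix01 m n) → (k : ℕ)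
    → 1 ≤ k → k ≤ n → S M k <ℚ 1ℚ
    → (∀ t → 1 ≤ t → t < k → ¬ (S M t <ℚ 1ℚ))
    → Σ (Subset n) (λ J → (∣ J ∣ ≡ k) × IsCovering M J)
theorem3p1 m n _ M k _ k≤n S<1 _ =
  let J , ∣J∣≤k , J-covers = light⇒covered k all-rows (S<1⇒light M k S<1)
      J′ , ∣J′∣≡k , J⊆J′   = superset-of-size k J ∣J∣≤k k≤n
  in J′ , ∣J′∣≡k , λ l → Covers-⊆ all-rows J⊆J′ J-covers l refl
  where
  open Covering M
  all-rows : Fin m → Bool
  all-rows _ = true
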